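{- For integers $i,j\ge0$ define the super Catalan numbers $S_{i,j}=\dfrac{(2i)!\,(2j)!}{2\,i!\,j!\,(i+j)!}$. Then for all integers $a,b\ge0$ and $n\ge1$, $$\det\left[S_{i+a,j+b}\right]_{i,j=1}^n=\frac{(-1)^{\binom n2}}{2^n\,n!}\prod_{i=1}^n\frac{(2a+2i)!\,(2b+2i)!\,i!}{(a+i)!\,(b+i)!\,(a+b+n+i)!}.$$ -}

module Defs where

open import Data.Nat as ℕ using (ℕ; zero; suc; _!)
open import Data.Nat.Properties using (_!≢0; _!*_!≢0; m*n≢0)
open import Data.Nat.Combinatorics using (_C_)
open import Data.Fin using (Fin; zero; suc; toℕ; punchIn)
open import Data.Integer as ℤ using (ℤ; +_; -[1+_])
open import Data.Rational as ℚ using (ℚ; _/_; 0ℚ; 1ℚ)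

negOnePow : ℕ → ℤ
negOnePow k = -[1+ 0 ] ℤ.^ k

ℤtoℚ : ℤ → ℚ
ℤtoℚ z = z / 1

ΣFin : ∀ n → (Fin n → ℚ) → ℚ
ΣFin zero    f = 0ℚ
ΣFin (suc n) f = f zero ℚ.+ ΣFin n (λ k → f (suc k))

prod1to : ℕ → (ℕ → ℚ) → ℚ
prod1to zero    f = 1ℚ
prod1to (suc n) f = prod1to n f ℚ.* f (suc n)

minor : ∀ {n} → (Fin (suc n) → Fin (suc n) → ℚ) → Fin (suc n) → Fin n → Fin n → ℚ
minor M j r c = M (suc r) (punchIn j c)

det : ∀ n → (Fin n → Fin n → ℚ) → ℚ
det zero    M = 1ℚ
det (suc n) M =
  ΣFin (suc n) (λ j → ℤtoℚ (negOnePow (toℕ j)) ℚ.* (M zero j ℚ.* det n (minor M j)))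

S : ℕ → ℕ → ℚ
S i j = _/_ (+ ((2 ℕ.* i) ! ℕ.* (2 ℕ.* j) !)) (2 ℕ.* (i ! ℕ.* j !) ℕ.* (i ℕ.+ j) !)
  {{ m*n≢0 (2 ℕ.* (i ! ℕ.* j !)) ((i ℕ.+ j) !)
       {{ m*n≢0 2 (i ! ℕ.* j !) {{ _ }} {{ i !* j !≢0 }} }} {{ (i ℕ.+ j) !≢0 }} }}

_/!_ : ℤ → ℕ → ℚ
z /! m = _/_ z (m !) {{ m !≢0 }}

RHS : ℕ → ℕ → ℕ → ℚ
RHS a b n =
  (_/_ (negOnePow (n C 2)) (2 ℕ.^ n ℕ.* n !) {{ m*n≢0 (2 ℕ.^ n) (n !) {{ pow2≢0 n }} {{ n !≢0 }} }})
  ℚ.* prod1to n (λ i →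
        ℤtoℚ (+ ((2 ℕ.* a ℕ.+ 2 ℕ.* i) ! ℕ.* (2 ℕ.* b ℕ.+ 2 ℕ.* i) ! ℕ.* i !))
        ℚ.* ((+ 1) /! (a ℕ.+ i)) ℚ.* ((+ 1) /! (b ℕ.+ i)) ℚ.* ((+ 1) /! (a ℕ.+ b ℕ.+ n ℕ.+ i)))
  where
  pow2≢0 : ∀ k → ℕ.NonZero (2 ℕ.^ k)
  pow2≢0 zero    = _
  pow2≢0 (suc k) = m*n≢0 2 (2 ℕ.^ k) {{ _ }} {{ pow2≢0 k }}

{-# OPTIONS --safe #-}
-- Writing S x y = w x · w′ y / (x + y)! with w x = (2x)!/x! and w′ y = (2y)!/(2 · y!), the weights
-- factor out of rows and columns, leaving the Hankel determinant det [1/(m+i+j)!] with m = a + b + 2.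
-- Subtracting 1/(m+j+1) times column j from column j+1 for all j kills the first row except 1/m!
-- and turns entry (r+1, c+1) into −(r+1)/(m+c+1) · 1/(m+2+r+c)!; hence the Hankel determinant of
-- order n+1 at m is (−1)^n n!/(m+n)! times the one of order n at m+2, which iterates to a product.
module Submission where

open import Defs
open import Data.Nat as ℕ using (ℕ; zero; suc; _+_; _≤_; _<_; z≤n; s≤s; _!; _≟_)
open import Data.Nat.Properties as ℕP using (_!≢0; _!*_!≢0; m*n≢0; m^n≢0)
open import Data.Nat.Combinatorics using (_C_; nCk+nC[k+1]≡[n+1]C[k+1]; nC1≡n)
open import Data.Nat.Tactic.RingSolver using (solve-∀)
open import Data.Fin as Fin using (Fin; toℕ; punchIn)
open import Data.Integer as ℤ using (+_; -[1+_])
import Data.Integer.Properties as ℤP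
open import Data.Rational as ℚ using (ℚ; _/_; 0ℚ; 1ℚ; _*_; -_)
import Data.Rational.Properties as ℚP
open import Data.Rational.Unnormalised using (mkℚᵘ; *≡*)
import Data.Rational.Unnormalised.Properties as ℚᵘP
open import Data.Rational.Solver using (module +-*-Solver)
open import Data.Product using (∃; _×_; _,_)
open import Data.Empty using (⊥-elim)
open import Function using (_∘_)
open import Relation.Nullary using (yes; no)
open import Relation.Binary.Definitions using (tri<; tri≈; tri>)
open import Relation.Binary.PropositionalEquality
open +-*-Solver

ℕtoℚ : ℕ → ℚ
ℕtoℚ n = ℤtoℚ (+ n)

ℤtoℚ-homo-* : ∀ x y → ℤtoℚ (x ℤ.* y) ≡ ℤtoℚ x * ℤtoℚ y
ℤtoℚ-homo-* x y = ℚP.toℚᵘ-injective (ℚᵘP.≃-trans (ℚP.toℚᵘ-fromℚᵘ (mkℚᵘ (x ℤ.* y) 0))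
  (ℚᵘP.≃-trans (ℚᵘP.≃-sym (ℚᵘP.*-cong (ℚP.toℚᵘ-fromℚᵘ (mkℚᵘ x 0)) (ℚP.toℚᵘ-fromℚᵘ (mkℚᵘ y 0))))
    (ℚᵘP.≃-sym (ℚP.toℚᵘ-homo-* (ℤtoℚ x) (ℤtoℚ y)))))

ℤtoℚ-homo-+ : ∀ x y → ℤtoℚ (x ℤ.+ y) ≡ ℤtoℚ x ℚ.+ ℤtoℚ y
ℤtoℚ-homo-+ x y = ℚP.toℚᵘ-injective (ℚᵘP.≃-trans (ℚP.toℚᵘ-fromℚᵘ (mkℚᵘ (x ℤ.+ y) 0))
  (ℚᵘP.≃-trans (ℚᵘP.≃-trans (*≡* (cong (ℤ._* + 1) (cong₂ ℤ._+_ (sym (ℤP.*-identityʳ x)) (sym (ℤP.*-identityʳ y)))))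
    (ℚᵘP.≃-sym (ℚᵘP.+-cong (ℚP.toℚᵘ-fromℚᵘ (mkℚᵘ x 0)) (ℚP.toℚᵘ-fromℚᵘ (mkℚᵘ y 0)))))
    (ℚᵘP.≃-sym (ℚP.toℚᵘ-homo-+ (ℤtoℚ x) (ℤtoℚ y)))))

ℕtoℚ-homo-* : ∀ m n → ℕtoℚ (m ℕ.* n) ≡ ℕtoℚ m * ℕtoℚ n
ℕtoℚ-homo-* m n = trans (cong ℤtoℚ (ℤP.pos-* m n)) (ℤtoℚ-homo-* (+ m) (+ n))

ℕtoℚ-homo-+ : ∀ m n → ℕtoℚ (m + n) ≡ ℕtoℚ m ℚ.+ ℕtoℚ n
ℕtoℚ-homo-+ m n = trans (cong ℤtoℚ (ℤP.pos-+ m n)) (ℤtoℚ-homo-+ (+ m) (+ n))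

recip : ∀ q .{{_ : ℕ.NonZero q}} → ℚ
recip q = + 1 / q

/-*-denominator : ∀ z q .{{_ : ℕ.NonZero q}} → (z / q) * ℕtoℚ q ≡ ℤtoℚ z
/-*-denominator z (suc q) = ℚP.toℚᵘ-injective (ℚᵘP.≃-trans (ℚP.toℚᵘ-homo-* (z / suc q) (ℕtoℚ (suc q)))
  (ℚᵘP.≃-trans (ℚᵘP.*-cong (ℚP.toℚᵘ-fromℚᵘ (mkℚᵘ z q)) (ℚP.toℚᵘ-fromℚᵘ (mkℚᵘ (+ suc q) 0)))
  (ℚᵘP.≃-trans (*≡* (ℤP.*-assoc z (+ suc q) (+ 1))) (ℚᵘP.≃-sym (ℚP.toℚᵘ-fromℚᵘ (mkℚᵘ z 0))))))

recip-inverseˡ : ∀ q .{{_ : ℕ.NonZero q}} → recip q * ℕtoℚ q ≡ 1ℚ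
recip-inverseˡ q = /-*-denominator (+ 1) q

*ℕtoℚ≡⇒≡*recip : ∀ q .{{_ : ℕ.NonZero q}} {x y : ℚ} → y * ℕtoℚ q ≡ x → y ≡ x * recip q
*ℕtoℚ≡⇒≡*recip q {x} {y} yq≡x = begin
  y                            ≡⟨ sym (ℚP.*-identityʳ y) ⟩
  y * 1ℚ                       ≡⟨ cong (y *_) (sym (recip-inverseˡ q)) ⟩
  y * (recip q * ℕtoℚ q)       ≡⟨ solve 3 (λ y r q → y :* (r :* q) := (y :* q) :* r) refl y (recip q) (ℕtoℚ q) ⟩
  (y * ℕtoℚ q) * recip q       ≡⟨ cong (_* recip q) yq≡x ⟩
  x * recip q                  ∎
  where open ≡-Reasoning

/≡*recip : ∀ z q .{{_ : ℕ.NonZero q}} → z / q ≡ ℤtoℚ z * recip q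
/≡*recip z q = *ℕtoℚ≡⇒≡*recip q (/-*-denominator z q)

recip-* : ∀ p q .{{_ : ℕ.NonZero p}} .{{_ : ℕ.NonZero q}} →
          recip (p ℕ.* q) {{m*n≢0 p q}} ≡ recip p * recip q
recip-* p q = sym (trans (*ℕtoℚ≡⇒≡*recip (p ℕ.* q) {{m*n≢0 p q}} inverse) (ℚP.*-identityˡ _))
  where
  open ≡-Reasoning
  inverse : recip p * recip q * ℕtoℚ (p ℕ.* q) ≡ 1ℚ
  inverse = begin
    recip p * recip q * ℕtoℚ (p ℕ.* q)         ≡⟨ cong (recip p * recip q *_) (ℕtoℚ-homo-* p q) ⟩
    recip p * recip q * (ℕtoℚ p * ℕtoℚ q)      ≡⟨ solve 4 (λ a b c d → a :* b :* (c :* d) := (a :* c) :* (b :* d)) refl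
                                                    (recip p) (recip q) (ℕtoℚ p) (ℕtoℚ q) ⟩
    (recip p * ℕtoℚ p) * (recip q * ℕtoℚ q)    ≡⟨ cong₂ _*_ (recip-inverseˡ p) (recip-inverseˡ q) ⟩
    1ℚ * 1ℚ                                    ≡⟨⟩
    1ℚ                                         ∎

invFact : ℕ → ℚ
invFact k = recip (k !) {{k !≢0}}

invFact-suc : ∀ k → invFact (suc k) ≡ invFact k * recip (suc k)
invFact-suc k = trans (recip-* (suc k) (k !) {{_}} {{k !≢0}}) (ℚP.*-comm (recip (suc k)) (invFact k))

invFact-suc-*-suc : ∀ k → invFact (suc k) * ℕtoℚ (suc k) ≡ invFact k
invFact-suc-*-suc k = begin
  invFact (suc k) * ℕtoℚ (suc k)                ≡⟨ cong (_* ℕtoℚ (suc k)) (invFact-suc k) ⟩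
  invFact k * recip (suc k) * ℕtoℚ (suc k)      ≡⟨ ℚP.*-assoc (invFact k) _ _ ⟩
  invFact k * (recip (suc k) * ℕtoℚ (suc k))    ≡⟨ cong (invFact k *_) (recip-inverseˡ (suc k)) ⟩
  invFact k * 1ℚ                                ≡⟨ ℚP.*-identityʳ (invFact k) ⟩
  invFact k                                     ∎
  where open ≡-Reasoning

sgn : ℕ → ℚ
sgn zero    = 1ℚ
sgn (suc k) = - sgn k

ℤtoℚ-negOnePow : ∀ k → ℤtoℚ (negOnePow k) ≡ sgn k
ℤtoℚ-negOnePow zero    = refl
ℤtoℚ-negOnePow (suc k) = trans (ℤtoℚ-homo-* -[1+ 0 ] (negOnePow k))
  (trans (cong (ℤtoℚ -[1+ 0 ] *_) (ℤtoℚ-negOnePow k))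
    (solve 1 (λ x → (:- con 1ℚ) :* x := :- x) refl (sgn k)))

sgn-+ : ∀ m n → sgn (m + n) ≡ sgn m * sgn n
sgn-+ zero    n = sym (ℚP.*-identityˡ (sgn n))
sgn-+ (suc m) n = trans (cong -_ (sgn-+ m n)) (solve 2 (λ x y → :- (x :* y) := (:- x) :* y) refl (sgn m) (sgn n))

∑< : ℕ → (ℕ → ℚ) → ℚ
∑< zero    f = 0ℚ
∑< (suc n) f = f 0 ℚ.+ ∑< n (f ∘ suc)

∏< : ℕ → (ℕ → ℚ) → ℚ
∏< zero    f = 1ℚ
∏< (suc n) f = f 0 * ∏< n (f ∘ suc)

ΣFin≡∑< : ∀ n (f : Fin n → ℚ) (g : ℕ → ℚ) → (∀ j → f j ≡ g (toℕ j)) → ΣFin n f ≡ ∑< n g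
ΣFin≡∑< zero    f g f≡g = refl
ΣFin≡∑< (suc n) f g f≡g = cong₂ ℚ._+_ (f≡g Fin.zero) (ΣFin≡∑< n (f ∘ Fin.suc) (g ∘ suc) (f≡g ∘ Fin.suc))

∑<-cong : ∀ n {f g : ℕ → ℚ} → (∀ j → j < n → f j ≡ g j) → ∑< n f ≡ ∑< n g
∑<-cong zero    f≡g = refl
∑<-cong (suc n) f≡g = cong₂ ℚ._+_ (f≡g 0 (s≤s z≤n)) (∑<-cong n (λ j j<n → f≡g (suc j) (s≤s j<n)))

∑<-zero : ∀ n {f : ℕ → ℚ} → (∀ j → j < n → f j ≡ 0ℚ) → ∑< n f ≡ 0ℚ
∑<-zero zero    f≡0 = refl
∑<-zero (suc n) f≡0 = cong₂ ℚ._+_ (f≡0 0 (s≤s z≤n)) (∑<-zero n (λ j j<n → f≡0 (suc j) (s≤s j<n)))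

∑<-distrib-+ : ∀ n (f g : ℕ → ℚ) → ∑< n (λ j → f j ℚ.+ g j) ≡ ∑< n f ℚ.+ ∑< n g
∑<-distrib-+ zero    f g = refl
∑<-distrib-+ (suc n) f g = trans (cong (f 0 ℚ.+ g 0 ℚ.+_) (∑<-distrib-+ n (f ∘ suc) (g ∘ suc)))
  (solve 4 (λ a b x y → a :+ b :+ (x :+ y) := a :+ x :+ (b :+ y)) refl (f 0) (g 0) (∑< n (f ∘ suc)) (∑< n (g ∘ suc)))

∑<-*ˡ : ∀ n (c : ℚ) (f : ℕ → ℚ) → ∑< n (λ j → c * f j) ≡ c * ∑< n f
∑<-*ˡ zero    c f = sym (ℚP.*-zeroʳ c)
∑<-*ˡ (suc n) c f = trans (cong (c * f 0 ℚ.+_) (∑<-*ˡ n c (f ∘ suc))) (sym (ℚP.*-distribˡ-+ c (f 0) _))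

∑<-pair : ∀ n k (f : ℕ → ℚ) → suc k < n → (∀ j → j < n → j ≢ k → j ≢ suc k → f j ≡ 0ℚ) →
          f k ℚ.+ f (suc k) ≡ 0ℚ → ∑< n f ≡ 0ℚ
∑<-pair (suc (suc n)) zero f _ others pair = begin
  f 0 ℚ.+ (f 1 ℚ.+ ∑< n (f ∘ suc ∘ suc))  ≡⟨ cong (λ z → f 0 ℚ.+ (f 1 ℚ.+ z))
                                               (∑<-zero n (λ j j<n → others (2 + j) (s≤s (s≤s j<n)) (λ ()) (λ ()))) ⟩
  f 0 ℚ.+ (f 1 ℚ.+ 0ℚ)                    ≡⟨ cong (f 0 ℚ.+_) (ℚP.+-identityʳ (f 1)) ⟩
  f 0 ℚ.+ f 1                             ≡⟨ pair ⟩
  0ℚ                                      ∎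
  where open ≡-Reasoning
∑<-pair (suc n) (suc k) f (s≤s sk<n) others pair =
  cong₂ ℚ._+_ (others 0 (s≤s z≤n) (λ ()) (λ ()))
    (∑<-pair n k (f ∘ suc) sk<n
      (λ j j<n j≢k j≢sk → others (suc j) (s≤s j<n) (j≢k ∘ ℕP.suc-injective) (j≢sk ∘ ℕP.suc-injective)) pair)

∏<-cong : ∀ n {f g : ℕ → ℚ} → (∀ j → f j ≡ g j) → ∏< n f ≡ ∏< n g
∏<-cong zero    f≡g = refl
∏<-cong (suc n) f≡g = cong₂ _*_ (f≡g 0) (∏<-cong n (f≡g ∘ suc))

∏<-back : ∀ n (f : ℕ → ℚ) → ∏< (suc n) f ≡ ∏< n f * f n
∏<-back zero    f = trans (ℚP.*-identityʳ (f 0)) (sym (ℚP.*-identityˡ (f 0)))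
∏<-back (suc n) f = trans (cong (f 0 *_) (∏<-back n (f ∘ suc))) (sym (ℚP.*-assoc (f 0) _ _))

∏<-distrib-* : ∀ n (f g : ℕ → ℚ) → ∏< n (λ j → f j * g j) ≡ ∏< n f * ∏< n g
∏<-distrib-* zero    f g = refl
∏<-distrib-* (suc n) f g = trans (cong (f 0 * g 0 *_) (∏<-distrib-* n (f ∘ suc) (g ∘ suc)))
  (solve 4 (λ a b x y → a :* b :* (x :* y) := a :* x :* (b :* y)) refl (f 0) (g 0) (∏< n (f ∘ suc)) (∏< n (g ∘ suc)))

∏<-const-recip : ∀ m n .{{m≢0 : ℕ.NonZero m}} → recip (m ℕ.^ n) {{m^n≢0 m n}} ≡ ∏< n (λ _ → recip m)
∏<-const-recip m zero            = refl
∏<-const-recip m (suc n) {{m≢0}} = trans (recip-* m (m ℕ.^ n) {{m≢0}} {{m^n≢0 m n}}) (cong (recip m *_) (∏<-const-recip m n))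

∏<-fact-suc : ∀ n → ∏< n (λ i → ℕtoℚ (suc i !)) ≡ ∏< n (λ i → ℕtoℚ (i !)) * ℕtoℚ (n !)
∏<-fact-suc n = trans (sym (ℚP.*-identityˡ _)) (∏<-back n (λ i → ℕtoℚ (i !)))

prod1to≡∏< : ∀ n (f : ℕ → ℚ) → prod1to n f ≡ ∏< n (f ∘ suc)
prod1to≡∏< zero    f = refl
prod1to≡∏< (suc n) f = trans (cong (_* f (suc n)) (prod1to≡∏< n f)) (sym (∏<-back n (f ∘ suc)))

punchInℕ : ℕ → ℕ → ℕ
punchInℕ zero    c       = suc c
punchInℕ (suc j) zero    = zero
punchInℕ (suc j) (suc c) = suc (punchInℕ j c)

toℕ-punchIn : ∀ {n} (j : Fin (suc n)) (c : Fin n) → toℕ (punchIn j c) ≡ punchInℕ (toℕ j) (toℕ c)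
toℕ-punchIn Fin.zero    c           = refl
toℕ-punchIn (Fin.suc j) Fin.zero    = refl
toℕ-punchIn (Fin.suc j) (Fin.suc c) = cong suc (toℕ-punchIn j c)

punchInℕ-below : ∀ {j c} → c < j → punchInℕ j c ≡ c
punchInℕ-below {suc j} {zero}  _         = refl
punchInℕ-below {suc j} {suc c} (s≤s c<j) = cong suc (punchInℕ-below c<j)

punchInℕ-above : ∀ {j c} → j ≤ c → punchInℕ j c ≡ suc c
punchInℕ-above {zero}            _         = refl
punchInℕ-above {suc j} {suc c}   (s≤s j≤c) = cong suc (punchInℕ-above j≤c)

punchInℕ-injective : ∀ j {c c′} → punchInℕ j c ≡ punchInℕ j c′ → c ≡ c′
punchInℕ-injective zero                      eq = ℕP.suc-injective eq
punchInℕ-injective (suc j) {zero}  {zero}    eq = refl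
punchInℕ-injective (suc j) {suc c} {suc c′}  eq = cong suc (punchInℕ-injective j (ℕP.suc-injective eq))

punchInℕ-≢ : ∀ j c → punchInℕ j c ≢ j
punchInℕ-≢ zero    c       ()
punchInℕ-≢ (suc j) zero    ()
punchInℕ-≢ (suc j) (suc c) eq = punchInℕ-≢ j c (ℕP.suc-injective eq)

punchInℕ-suc : ∀ {k c} → c ≢ k → punchInℕ k c ≡ punchInℕ (suc k) c
punchInℕ-suc {zero}  {zero}  c≢k = ⊥-elim (c≢k refl)
punchInℕ-suc {zero}  {suc c} c≢k = refl
punchInℕ-suc {suc k} {zero}  c≢k = refl
punchInℕ-suc {suc k} {suc c} c≢k = cong suc (punchInℕ-suc (c≢k ∘ cong suc))

punchInℕ-bounded : ∀ j {c n} → c < n → punchInℕ j c < suc n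
punchInℕ-bounded zero              c<n       = s≤s c<n
punchInℕ-bounded (suc j) {zero}    c<n       = s≤s z≤n
punchInℕ-bounded (suc j) {suc c}   (s≤s c<n) = s≤s (punchInℕ-bounded j c<n)

punchInℕ-bounded⁻¹ : ∀ {j c n} → j ≤ n → punchInℕ j c < suc n → c < n
punchInℕ-bounded⁻¹ {zero}                   _         (s≤s c<n) = c<n
punchInℕ-bounded⁻¹ {suc j} {zero}  {suc n}  _         _         = s≤s z≤n
punchInℕ-bounded⁻¹ {suc j} {suc c} {suc n}  (s≤s j≤n) (s≤s p)   = s≤s (punchInℕ-bounded⁻¹ j≤n p)

punchInℕ-surjective : ∀ {j k} → j ≢ k → ∃ λ c → punchInℕ j c ≡ k
punchInℕ-surjective {zero}  {zero}  j≢k = ⊥-elim (j≢k refl)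
punchInℕ-surjective {zero}  {suc k} _   = k , refl
punchInℕ-surjective {suc j} {zero}  _   = zero , refl
punchInℕ-surjective {suc j} {suc k} j≢k with punchInℕ-surjective (j≢k ∘ cong suc)
... | c , eq = suc c , cong suc eq

punchInℕ-adjacent : ∀ {j k} → j ≢ k → j ≢ suc k → ∃ λ c → punchInℕ j c ≡ k × punchInℕ j (suc c) ≡ suc k
punchInℕ-adjacent {zero}        {zero}  j≢k _    = ⊥-elim (j≢k refl)
punchInℕ-adjacent {zero}        {suc k} _   _    = k , refl , refl
punchInℕ-adjacent {suc zero}    {zero}  _   j≢sk = ⊥-elim (j≢sk refl)
punchInℕ-adjacent {suc (suc j)} {zero}  _   _    = zero , refl , refl
punchInℕ-adjacent {suc j}       {suc k} j≢k j≢sk with punchInℕ-adjacent (j≢k ∘ cong suc) (j≢sk ∘ cong suc)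
... | c , eq , eq′ = suc c , cong suc eq , cong suc eq′

∏<-punchIn : ∀ j n (f : ℕ → ℚ) → j ≤ n → f j * ∏< n (f ∘ punchInℕ j) ≡ ∏< (suc n) f
∏<-punchIn zero    n       f _         = refl
∏<-punchIn (suc j) (suc n) f (s≤s j≤n) = trans
  (solve 3 (λ a b q → a :* (b :* q) := b :* (a :* q)) refl (f (suc j)) (f 0) (∏< n (f ∘ suc ∘ punchInℕ j)))
  (cong (f 0 *_) (∏<-punchIn j n (f ∘ suc) j≤n))

-- Matrices are indexed by ℕ to avoid Fin arithmetic; det′ n reads only the top-left n × n block.
Mat : Set
Mat = ℕ → ℕ → ℚ

minor′ : Mat → ℕ → Mat
minor′ M j r c = M (suc r) (punchInℕ j c)

det′ : ℕ → Mat → ℚ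
expansionTerm : ℕ → Mat → ℕ → ℚ

det′ zero    M = 1ℚ
det′ (suc n) M = ∑< (suc n) (expansionTerm n M)

expansionTerm n M j = sgn j * (M 0 j * det′ n (minor′ M j))

det≡det′ : ∀ n (M : Fin n → Fin n → ℚ) (N : Mat) → (∀ i j → M i j ≡ N (toℕ i) (toℕ j)) → det n M ≡ det′ n N
det≡det′ zero    M N M≡N = refl
det≡det′ (suc n) M N M≡N = ΣFin≡∑< (suc n) _ (expansionTerm n N) (λ j →
  cong₂ _*_ (ℤtoℚ-negOnePow (toℕ j)) (cong₂ _*_ (M≡N Fin.zero j)
    (det≡det′ n (minor M j) (minor′ N (toℕ j))
      (λ r c → trans (M≡N (Fin.suc r) (punchIn j c)) (cong (N (suc (toℕ r))) (toℕ-punchIn j c))))))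

det′-cong : ∀ n {M N : Mat} → (∀ i j → i < n → j < n → M i j ≡ N i j) → det′ n M ≡ det′ n N
det′-cong zero    M≡N = refl
det′-cong (suc n) M≡N = ∑<-cong (suc n) λ j j<n → cong (sgn j *_) (cong₂ _*_ (M≡N 0 j (s≤s z≤n) j<n)
  (det′-cong n λ r c r<n c<n → M≡N (suc r) (punchInℕ j c) (s≤s r<n) (punchInℕ-bounded j c<n)))

det′-scaleRows : ∀ n (r : ℕ → ℚ) (M : Mat) → det′ n (λ i j → r i * M i j) ≡ ∏< n r * det′ n M
det′-scaleRows zero    r M = sym (ℚP.*-identityˡ 1ℚ)
det′-scaleRows (suc n) r M = trans (∑<-cong (suc n) λ j _ → term j) (∑<-*ˡ (suc n) (∏< (suc n) r) (expansionTerm n M))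
  where
  term : ∀ j → expansionTerm n (λ i j → r i * M i j) j ≡ ∏< (suc n) r * expansionTerm n M j
  term j = trans (cong (λ d → sgn j * (r 0 * M 0 j * d)) (det′-scaleRows n (r ∘ suc) (minor′ M j)))
    (solve 5 (λ s a m p d → s :* (a :* m :* (p :* d)) := a :* p :* (s :* (m :* d))) refl
      (sgn j) (r 0) (M 0 j) (∏< n (r ∘ suc)) (det′ n (minor′ M j)))

det′-scaleCols : ∀ n (c : ℕ → ℚ) (M : Mat) → det′ n (λ i j → c j * M i j) ≡ ∏< n c * det′ n M
det′-scaleCols zero    c M = sym (ℚP.*-identityˡ 1ℚ)
det′-scaleCols (suc n) c M = trans (∑<-cong (suc n) term) (∑<-*ˡ (suc n) (∏< (suc n) c) (expansionTerm n M))
  where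
  term : ∀ j → j < suc n → expansionTerm n (λ i j → c j * M i j) j ≡ ∏< (suc n) c * expansionTerm n M j
  term j (s≤s j≤n) = trans (cong (λ d → sgn j * (c j * M 0 j * d)) (det′-scaleCols n (c ∘ punchInℕ j) (minor′ M j)))
    (trans (solve 5 (λ s a m p d → s :* (a :* m :* (p :* d)) := a :* p :* (s :* (m :* d))) refl
             (sgn j) (c j) (M 0 j) (∏< n (c ∘ punchInℕ j)) (det′ n (minor′ M j)))
      (cong (_* expansionTerm n M j) (∏<-punchIn j n c j≤n)))

det′-firstRow-corner : ∀ n (M : Mat) → (∀ j → M 0 (suc j) ≡ 0ℚ) →
  det′ (suc n) M ≡ M 0 0 * det′ n (λ r c → M (suc r) (suc c))
det′-firstRow-corner n M row₀ = begin
  expansionTerm n M 0 ℚ.+ ∑< n (expansionTerm n M ∘ suc)  ≡⟨ cong (expansionTerm n M 0 ℚ.+_) (∑<-zero n (λ j _ → vanish j)) ⟩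
  expansionTerm n M 0 ℚ.+ 0ℚ                              ≡⟨ ℚP.+-identityʳ _ ⟩
  1ℚ * (M 0 0 * det′ n (minor′ M 0))                      ≡⟨ ℚP.*-identityˡ _ ⟩
  M 0 0 * det′ n (λ r c → M (suc r) (suc c))              ∎
  where
  open ≡-Reasoning
  vanish : ∀ j → expansionTerm n M (suc j) ≡ 0ℚ
  vanish j = trans (cong (λ m → sgn (suc j) * (m * det′ n (minor′ M (suc j)))) (row₀ j))
    (solve 2 (λ s d → s :* (con 0ℚ :* d) := con 0ℚ) refl (sgn (suc j)) (det′ n (minor′ M (suc j))))

det′-linearInColumn : ∀ n k (c : ℚ) (P M L : Mat) → k < n →
  (∀ i j → j ≢ k → P i j ≡ M i j) → (∀ i j → j ≢ k → L i j ≡ M i j) →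
  (∀ i → P i k ≡ M i k ℚ.+ c * L i k) → det′ n P ≡ det′ n M ℚ.+ c * det′ n L
det′-linearInColumn (suc n) k c P M L k<n P≡M L≡M colₖ =
  trans (∑<-cong (suc n) term)
    (trans (∑<-distrib-+ (suc n) (expansionTerm n M) (λ j → c * expansionTerm n L j))
      (cong (det′ (suc n) M ℚ.+_) (∑<-*ˡ (suc n) c (expansionTerm n L))))
  where
  open ≡-Reasoning
  term : ∀ j → j < suc n → expansionTerm n P j ≡ expansionTerm n M j ℚ.+ c * expansionTerm n L j
  term j j<n with j ≟ k
  ... | yes refl = begin
    sgn j * (P 0 j * det′ n (minor′ P j))
      ≡⟨ cong₂ (λ p d → sgn j * (p * d)) (colₖ 0) (minor≡ P P≡M) ⟩
    sgn j * ((M 0 j ℚ.+ c * L 0 j) * det′ n (minor′ M j))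
      ≡⟨ solve 5 (λ s m c l d → s :* ((m :+ c :* l) :* d) := s :* (m :* d) :+ c :* (s :* (l :* d))) refl
           (sgn j) (M 0 j) c (L 0 j) (det′ n (minor′ M j)) ⟩
    expansionTerm n M j ℚ.+ c * (sgn j * (L 0 j * det′ n (minor′ M j)))
      ≡⟨ cong (λ d → expansionTerm n M j ℚ.+ c * (sgn j * (L 0 j * d))) (sym (minor≡ L L≡M)) ⟩
    expansionTerm n M j ℚ.+ c * expansionTerm n L j
      ∎
    where
    minor≡ : ∀ X → (∀ i j → j ≢ k → X i j ≡ M i j) → det′ n (minor′ X j) ≡ det′ n (minor′ M j)
    minor≡ X X≡M = det′-cong n λ r c′ _ _ → X≡M (suc r) (punchInℕ j c′) (punchInℕ-≢ j c′)
  ... | no j≢k with punchInℕ-surjective j≢k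
  ... | k′ , refl = begin
    sgn j * (P 0 j * det′ n (minor′ P j))
      ≡⟨ cong₂ (λ p d → sgn j * (p * d)) (P≡M 0 j j≢k) minor-linear ⟩
    sgn j * (M 0 j * (det′ n (minor′ M j) ℚ.+ c * det′ n (minor′ L j)))
      ≡⟨ solve 5 (λ s m c d l → s :* (m :* (d :+ c :* l)) := s :* (m :* d) :+ c :* (s :* (m :* l))) refl
           (sgn j) (M 0 j) c (det′ n (minor′ M j)) (det′ n (minor′ L j)) ⟩
    expansionTerm n M j ℚ.+ c * (sgn j * (M 0 j * det′ n (minor′ L j)))
      ≡⟨ cong (λ l → expansionTerm n M j ℚ.+ c * (sgn j * (l * det′ n (minor′ L j)))) (sym (L≡M 0 j j≢k)) ⟩
    expansionTerm n M j ℚ.+ c * expansionTerm n L j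
      ∎
    where
    away : ∀ c′ → c′ ≢ k′ → punchInℕ j c′ ≢ punchInℕ j k′
    away c′ c′≢k′ = c′≢k′ ∘ punchInℕ-injective j
    minor-linear : det′ n (minor′ P j) ≡ det′ n (minor′ M j) ℚ.+ c * det′ n (minor′ L j)
    minor-linear = det′-linearInColumn n k′ c (minor′ P j) (minor′ M j) (minor′ L j)
      (punchInℕ-bounded⁻¹ (ℕP.≤-pred j<n) k<n)
      (λ r c′ c′≢k′ → P≡M (suc r) (punchInℕ j c′) (away c′ c′≢k′))
      (λ r c′ c′≢k′ → L≡M (suc r) (punchInℕ j c′) (away c′ c′≢k′))
      (λ r → colₖ (suc r))

det′-equalAdjacentColumns : ∀ n k (M : Mat) → suc k < n → (∀ i → M i k ≡ M i (suc k)) → det′ n M ≡ 0ℚ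
det′-equalAdjacentColumns (suc n) k M sk<sn colₖ≡colₛₖ = ∑<-pair (suc n) k (expansionTerm n M) sk<sn others pair
  where
  others : ∀ j → j < suc n → j ≢ k → j ≢ suc k → expansionTerm n M j ≡ 0ℚ
  others j (s≤s j≤n) j≢k j≢sk with punchInℕ-adjacent j≢k j≢sk
  ... | c , refl , eq = trans (cong (λ d → sgn j * (M 0 j * d)) minor-vanishes)
                          (solve 2 (λ s m → s :* (m :* con 0ℚ) := con 0ℚ) refl (sgn j) (M 0 j))
    where
    minor-vanishes : det′ n (minor′ M j) ≡ 0ℚ
    minor-vanishes = det′-equalAdjacentColumns n c (minor′ M j)
      (punchInℕ-bounded⁻¹ j≤n (subst (_< suc n) (sym eq) sk<sn))
      (λ r → trans (colₖ≡colₛₖ (suc r)) (cong (M (suc r)) (sym eq)))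
  minors≡ : ∀ r c → minor′ M k r c ≡ minor′ M (suc k) r c
  minors≡ r c with c ≟ k
  ... | yes refl = trans (cong (M (suc r)) (punchInℕ-above ℕP.≤-refl))
                     (trans (sym (colₖ≡colₛₖ (suc r))) (cong (M (suc r)) (sym (punchInℕ-below ℕP.≤-refl))))
  ... | no c≢k   = cong (M (suc r)) (punchInℕ-suc c≢k)
  pair : expansionTerm n M k ℚ.+ expansionTerm n M (suc k) ≡ 0ℚ
  pair = trans (cong₂ (λ m d → expansionTerm n M k ℚ.+ sgn (suc k) * (m * d))
                  (sym (colₖ≡colₛₖ 0)) (sym (det′-cong n (λ r c _ _ → minors≡ r c))))
    (solve 3 (λ s m d → s :* (m :* d) :+ (:- s) :* (m :* d) := con 0ℚ) refl (sgn k) (M 0 k) (det′ n (minor′ M k)))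

det′-addColumn : ∀ n k (e : ℚ) (N M : Mat) → suc k < n → (∀ i j → j ≢ suc k → N i j ≡ M i j) →
  (∀ i → N i (suc k) ≡ M i (suc k) ℚ.+ e * M i k) → det′ n N ≡ det′ n M
det′-addColumn n k e N M sk<n N≡M colₛₖ = begin
  det′ n N                    ≡⟨ det′-linearInColumn n (suc k) e N M L sk<n N≡M L≡M colₛₖ′ ⟩
  det′ n M ℚ.+ e * det′ n L   ≡⟨ cong (λ d → det′ n M ℚ.+ e * d) (det′-equalAdjacentColumns n k L sk<n L-adjacent) ⟩
  det′ n M ℚ.+ e * 0ℚ         ≡⟨ solve 2 (λ d e → d :+ e :* con 0ℚ := d) refl (det′ n M) e ⟩
  det′ n M                    ∎
  where
  open ≡-Reasoning
  L : Mat
  L i j with j ≟ suc k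
  ... | yes _ = M i k
  ... | no  _ = M i j
  L≡M : ∀ i j → j ≢ suc k → L i j ≡ M i j
  L≡M i j j≢sk with j ≟ suc k
  ... | yes j≡sk = ⊥-elim (j≢sk j≡sk)
  ... | no  _    = refl
  L-copy : ∀ i → L i (suc k) ≡ M i k
  L-copy i with suc k ≟ suc k
  ... | yes _   = refl
  ... | no  k≢k = ⊥-elim (k≢k refl)
  L-adjacent : ∀ i → L i k ≡ L i (suc k)
  L-adjacent i = trans (L≡M i k (ℕP.1+n≢n ∘ sym)) (sym (L-copy i))
  colₛₖ′ : ∀ i → N i (suc k) ≡ M i (suc k) ℚ.+ e * L i (suc k)
  colₛₖ′ i = trans (colₛₖ i) (cong (λ x → M i (suc k) ℚ.+ e * x) (sym (L-copy i)))

downwardInduction : ∀ {p} (P : ℕ → Set p) n →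
  (∀ t → n ≤ suc t → P t) → (∀ t → suc t < n → P (suc t) → P t) → ∀ t → P t
downwardInduction P n base step t = go n t (ℕP.m≤m+n n (suc t))
  where
  go : ∀ fuel t → n ≤ fuel + suc t → P t
  go zero        t n≤st = base t n≤st
  go (suc fuel)  t n≤   with n ℕP.≤? suc t
  ... | yes n≤st = base t n≤st
  ... | no  n≰st = step t (ℕP.≰⇒> n≰st) (go fuel (suc t) (subst (n ≤_) (sym (ℕP.+-suc fuel (suc t))) n≤))

if_≤_then_else_ : ℕ → ℕ → ℚ → ℚ → ℚ
if zero  ≤ j     then x else y = x
if suc t ≤ zero  then x else y = y
if suc t ≤ suc j then x else y = if t ≤ j then x else y

if-≤ : ∀ {t j} x y → t ≤ j → (if t ≤ j then x else y) ≡ x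
if-≤ {zero}          x y _         = refl
if-≤ {suc t} {suc j} x y (s≤s t≤j) = if-≤ x y t≤j

if-> : ∀ {t j} x y → j < t → (if t ≤ j then x else y) ≡ y
if-> {suc t} {zero}  x y _         = refl
if-> {suc t} {suc j} x y (s≤s j<t) = if-> x y j<t

det′-addColumns : ∀ n (e : ℕ → ℚ) (N M : Mat) → (∀ i → N i 0 ≡ M i 0) →
  (∀ i j → N i (suc j) ≡ M i (suc j) ℚ.+ e j * M i j) → det′ n N ≡ det′ n M
det′-addColumns n e N M col₀ colₛ =
  trans (det′-cong n (λ i j _ _ → N≡Q₀ i j)) (downwardInduction (λ t → det′ n (Q t) ≡ det′ n M) n done sweep 0)
  where
  Q : ℕ → Mat
  Q t i zero    = M i zero
  Q t i (suc j) = if t ≤ j then M i (suc j) ℚ.+ e j * M i j else M i (suc j)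
  N≡Q₀ : ∀ i j → N i j ≡ Q 0 i j
  N≡Q₀ i zero    = col₀ i
  N≡Q₀ i (suc j) = colₛ i j
  Q-untouched : ∀ t i j → j ≤ t → Q t i j ≡ M i j
  Q-untouched t i zero    _    = refl
  Q-untouched t i (suc j) j<t  = if-> _ _ j<t
  done : ∀ t → n ≤ suc t → det′ n (Q t) ≡ det′ n M
  done t n≤st = det′-cong n (λ i j _ j<n → Q-untouched t i j (ℕP.≤-pred (ℕP.≤-trans j<n n≤st)))
  sweep : ∀ t → suc t < n → det′ n (Q (suc t)) ≡ det′ n M → det′ n (Q t) ≡ det′ n M
  sweep t st<n IH = trans (det′-addColumn n t (e t) (Q t) (Q (suc t)) st<n Qₜ≡Qₜ₊₁ colₛₜ) IH
    where
    Qₜ≡Qₜ₊₁ : ∀ i j → j ≢ suc t → Q t i j ≡ Q (suc t) i j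
    Qₜ≡Qₜ₊₁ i zero    _ = refl
    Qₜ≡Qₜ₊₁ i (suc j) j≢t with ℕP.<-cmp j t
    ... | tri< j<t _ _ = trans (if-> _ _ j<t) (sym (if-> _ _ (ℕP.m<n⇒m<1+n j<t)))
    ... | tri≈ _ j≡t _ = ⊥-elim (j≢t (cong suc j≡t))
    ... | tri> _ _ t<j = trans (if-≤ _ _ (ℕP.<⇒≤ t<j)) (sym (if-≤ _ _ t<j))
    colₛₜ : ∀ i → Q t i (suc t) ≡ Q (suc t) i (suc t) ℚ.+ e t * Q (suc t) i t
    colₛₜ i = trans (if-≤ {t} {t} _ _ ℕP.≤-refl)
      (cong₂ (λ a b → a ℚ.+ e t * b) (sym (if-> {suc t} {t} _ _ ℕP.≤-refl)) (sym (Q-untouched (suc t) i t (ℕP.n≤1+n t))))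

invFactHankel : ℕ → Mat
invFactHankel m i j = invFact (m + i + j)

invFactHankel-firstRow-step : ∀ m j →
  invFactHankel m 0 (suc j) ℚ.+ (- recip (suc (m + j))) * invFactHankel m 0 j ≡ 0ℚ
invFactHankel-firstRow-step m j = begin
  invFact (m + 0 + suc j) ℚ.+ (- s) * invFact (m + 0 + j)  ≡⟨ cong₂ (λ a b → invFact a ℚ.+ (- s) * invFact b) (index₁ m j) (index₀ m j) ⟩
  invFact (suc (m + j)) ℚ.+ (- s) * invFact (m + j)        ≡⟨ cong (ℚ._+ (- s) * invFact (m + j)) (invFact-suc (m + j)) ⟩
  invFact (m + j) * s ℚ.+ (- s) * invFact (m + j)          ≡⟨ solve 2 (λ x s → x :* s :+ (:- s) :* x := con 0ℚ) refl (invFact (m + j)) s ⟩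
  0ℚ                                                       ∎
  where
  open ≡-Reasoning
  s = recip (suc (m + j))
  index₀ : ∀ m j → m + 0 + j ≡ m + j
  index₀ = solve-∀
  index₁ : ∀ m j → m + 0 + suc j ≡ suc (m + j)
  index₁ = solve-∀

-- With K = m + r + c + 1, the left side is (1/(K+1)!) (1 − (K+1)/(m+c+1)) and K + 1 − (m+c+1) = r + 1.
invFactHankel-lowerRows-step : ∀ m r c →
  invFactHankel m (suc r) (suc c) ℚ.+ (- recip (suc (m + c))) * invFactHankel m (suc r) c
  ≡ (- ℕtoℚ (suc r)) * (recip (suc (m + c)) * invFactHankel (2 + m) r c)
invFactHankel-lowerRows-step m r c = begin
  invFact (m + suc r + suc c) ℚ.+ (- s) * invFact (m + suc r + c)
    ≡⟨ cong₂ (λ a b → invFact a ℚ.+ (- s) * invFact b) (index₂ m r c) (index₁ m r c) ⟩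
  F ℚ.+ (- s) * invFact K
    ≡⟨ cong (λ z → F ℚ.+ (- s) * z) (sym (invFact-suc-*-suc K)) ⟩
  F ℚ.+ (- s) * (F * ℕtoℚ (suc K))
    ≡⟨ cong (λ z → F ℚ.+ (- s) * (F * z)) (trans (cong ℕtoℚ (split m r c)) (ℕtoℚ-homo-+ (suc (m + c)) (suc r))) ⟩
  F ℚ.+ (- s) * (F * (a ℚ.+ b))
    ≡⟨ solve 4 (λ F s a b → F :+ (:- s) :* (F :* (a :+ b)) := F :* (con 1ℚ :- s :* a) :+ (:- b) :* (s :* F)) refl F s a b ⟩
  F * (1ℚ ℚ.- s * a) ℚ.+ (- b) * (s * F)
    ≡⟨ cong (λ z → F * (1ℚ ℚ.- z) ℚ.+ (- b) * (s * F)) (recip-inverseˡ (suc (m + c))) ⟩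
  F * (1ℚ ℚ.- 1ℚ) ℚ.+ (- b) * (s * F)
    ≡⟨ solve 3 (λ F s b → F :* (con 1ℚ :- con 1ℚ) :+ (:- b) :* (s :* F) := (:- b) :* (s :* F)) refl F s b ⟩
  (- b) * (s * F)
    ∎
  where
  open ≡-Reasoning
  s = recip (suc (m + c))
  K = suc (m + r + c)
  F = invFact (suc K)
  a = ℕtoℚ (suc (m + c))
  b = ℕtoℚ (suc r)
  index₁ : ∀ m r c → m + suc r + c ≡ suc (m + r + c)
  index₁ = solve-∀
  index₂ : ∀ m r c → m + suc r + suc c ≡ suc (suc (m + r + c))
  index₂ = solve-∀
  split : ∀ m r c → suc (suc (m + r + c)) ≡ suc (m + c) + suc r
  split = solve-∀

∏<-neg-suc : ∀ n → ∏< n (λ r → - ℕtoℚ (suc r)) ≡ sgn n * ℕtoℚ (n !)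
∏<-neg-suc zero    = refl
∏<-neg-suc (suc n) = begin
  ∏< (suc n) (λ r → - ℕtoℚ (suc r))             ≡⟨ ∏<-back n _ ⟩
  ∏< n (λ r → - ℕtoℚ (suc r)) * - ℕtoℚ (suc n)  ≡⟨ cong (_* - ℕtoℚ (suc n)) (∏<-neg-suc n) ⟩
  sgn n * ℕtoℚ (n !) * - ℕtoℚ (suc n)           ≡⟨ solve 3 (λ s f k → s :* f :* (:- k) := (:- s) :* (k :* f)) refl
                                                     (sgn n) (ℕtoℚ (n !)) (ℕtoℚ (suc n)) ⟩
  - sgn n * (ℕtoℚ (suc n) * ℕtoℚ (n !))         ≡⟨ cong (- sgn n *_) (sym (ℕtoℚ-homo-* (suc n) (n !))) ⟩
  sgn (suc n) * ℕtoℚ (suc n !)                  ∎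
  where open ≡-Reasoning

invFact-*-∏<-recip : ∀ m n → invFact m * ∏< n (λ c → recip (suc (m + c))) ≡ invFact (m + n)
invFact-*-∏<-recip m zero    = trans (ℚP.*-identityʳ (invFact m)) (cong invFact (sym (ℕP.+-identityʳ m)))
invFact-*-∏<-recip m (suc n) = begin
  invFact m * ∏< (suc n) r    ≡⟨ cong (invFact m *_) (∏<-back n r) ⟩
  invFact m * (∏< n r * r n)  ≡⟨ sym (ℚP.*-assoc (invFact m) _ _) ⟩
  invFact m * ∏< n r * r n    ≡⟨ cong (_* r n) (invFact-*-∏<-recip m n) ⟩
  invFact (m + n) * r n       ≡⟨ sym (invFact-suc (m + n)) ⟩
  invFact (suc (m + n))       ≡⟨ cong invFact (sym (ℕP.+-suc m n)) ⟩
  invFact (m + suc n)         ∎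
  where
  open ≡-Reasoning
  r : ℕ → ℚ
  r c = recip (suc (m + c))

det′-invFactHankel-step : ∀ m n →
  det′ (suc n) (invFactHankel m) ≡ sgn n * ℕtoℚ (n !) * invFact (m + n) * det′ n (invFactHankel (2 + m))
det′-invFactHankel-step m n = begin
  det′ (suc n) (invFactHankel m)
    ≡⟨ sym (det′-addColumns (suc n) e N (invFactHankel m) (λ i → refl) (λ i j → refl)) ⟩
  det′ (suc n) N
    ≡⟨ det′-firstRow-corner n N (invFactHankel-firstRow-step m) ⟩
  N 0 0 * det′ n (λ r c → N (suc r) (suc c))
    ≡⟨ cong (N 0 0 *_) (det′-cong n (λ r c _ _ → invFactHankel-lowerRows-step m r c)) ⟩
  N 0 0 * det′ n (λ r c → (- ℕtoℚ (suc r)) * (w c * invFactHankel (2 + m) r c))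
    ≡⟨ cong (N 0 0 *_) (det′-scaleRows n (λ r → - ℕtoℚ (suc r)) _) ⟩
  N 0 0 * (∏< n (λ r → - ℕtoℚ (suc r)) * det′ n (λ r c → w c * invFactHankel (2 + m) r c))
    ≡⟨ cong (λ z → N 0 0 * (∏< n (λ r → - ℕtoℚ (suc r)) * z)) (det′-scaleCols n w _) ⟩
  N 0 0 * (∏< n (λ r → - ℕtoℚ (suc r)) * (∏< n w * D))
    ≡⟨ solve 4 (λ a b c d → a :* (b :* (c :* d)) := b :* (a :* c) :* d) refl (N 0 0) (∏< n (λ r → - ℕtoℚ (suc r))) (∏< n w) D ⟩
  ∏< n (λ r → - ℕtoℚ (suc r)) * (N 0 0 * ∏< n w) * D
    ≡⟨ cong₂ (λ x y → x * y * D) (∏<-neg-suc n)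
         (trans (cong (λ k → invFact k * ∏< n w) (trans (ℕP.+-identityʳ (m + 0)) (ℕP.+-identityʳ m))) (invFact-*-∏<-recip m n)) ⟩
  sgn n * ℕtoℚ (n !) * invFact (m + n) * D
    ∎
  where
  open ≡-Reasoning
  w : ℕ → ℚ
  w c = recip (suc (m + c))
  e : ℕ → ℚ
  e j = - w j
  N : Mat
  N i zero    = invFactHankel m i zero
  N i (suc j) = invFactHankel m i (suc j) ℚ.+ e j * invFactHankel m i j
  D = det′ n (invFactHankel (2 + m))

[n+1]C2≡n+nC2 : ∀ n → suc n C 2 ≡ n + n C 2
[n+1]C2≡n+nC2 n = trans (sym (nCk+nC[k+1]≡[n+1]C[k+1] n 1)) (cong (_+ n C 2) (nC1≡n n))

det′-invFactHankel : ∀ c n →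
  det′ n (invFactHankel (2 + c)) ≡ sgn (n C 2) * (∏< n (λ i → ℕtoℚ (i !)) * ∏< n (λ i → invFact (c + n + suc i)))
det′-invFactHankel c zero    = refl
det′-invFactHankel c (suc n) = begin
  det′ (suc n) (invFactHankel (2 + c))
    ≡⟨ det′-invFactHankel-step (2 + c) n ⟩
  s * f * h * det′ n (invFactHankel (4 + c))
    ≡⟨ cong (s * f * h *_) (det′-invFactHankel (2 + c) n) ⟩
  s * f * h * (t * (F * G))
    ≡⟨ solve 6 (λ s f h t F G → s :* f :* h :* (t :* (F :* G)) := s :* t :* (F :* f :* (h :* G))) refl s f h t F G ⟩
  s * t * (F * f * (h * G))
    ≡⟨ cong₂ _*_ (trans (sym (sgn-+ n (n C 2))) (cong sgn (sym ([n+1]C2≡n+nC2 n))))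
         (cong₂ _*_ (sym (∏<-back n (λ i → ℕtoℚ (i !))))
           (cong₂ _*_ (cong invFact (index₀ c n)) (∏<-cong n (λ i → cong invFact (indexₛ c n i))))) ⟩
  sgn (suc n C 2) * (∏< (suc n) (λ i → ℕtoℚ (i !)) * ∏< (suc n) (λ i → invFact (c + suc n + suc i)))
    ∎
  where
  open ≡-Reasoning
  s = sgn n
  t = sgn (n C 2)
  f = ℕtoℚ (n !)
  h = invFact (2 + c + n)
  F = ∏< n (λ i → ℕtoℚ (i !))
  G = ∏< n (λ i → invFact (2 + c + n + suc i))
  index₀ : ∀ c n → 2 + c + n ≡ c + suc n + 1
  index₀ = solve-∀
  indexₛ : ∀ c n i → 2 + c + n + suc i ≡ c + suc n + suc (suc i)
  indexₛ = solve-∀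

rowWeight : ℕ → ℚ
rowWeight x = ℕtoℚ ((2 ℕ.* x) !) * invFact x

columnWeight : ℕ → ℚ
columnWeight y = recip 2 * (ℕtoℚ ((2 ℕ.* y) !) * invFact y)

S-factorisation : ∀ x y → S x y ≡ rowWeight x * (columnWeight y * invFact (x + y))
S-factorisation x y = begin
  S x y
    ≡⟨ /≡*recip (+ (p ℕ.* q)) (2 ℕ.* (x ! ℕ.* y !) ℕ.* (x + y) !) {{m*n≢0 _ _ {{2x!y!≢0}} {{(x + y) !≢0}}}} ⟩
  ℕtoℚ (p ℕ.* q) * recip (2 ℕ.* (x ! ℕ.* y !) ℕ.* (x + y) !) {{m*n≢0 _ _ {{2x!y!≢0}} {{(x + y) !≢0}}}}
    ≡⟨ cong₂ _*_ (ℕtoℚ-homo-* p q) (recip-* (2 ℕ.* (x ! ℕ.* y !)) ((x + y) !) {{2x!y!≢0}} {{(x + y) !≢0}}) ⟩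
  ℕtoℚ p * ℕtoℚ q * (recip (2 ℕ.* (x ! ℕ.* y !)) {{2x!y!≢0}} * invFact (x + y))
    ≡⟨ cong (λ z → ℕtoℚ p * ℕtoℚ q * (z * invFact (x + y)))
         (trans (recip-* 2 (x ! ℕ.* y !) {{_}} {{x !* y !≢0}}) (cong (recip 2 *_) (recip-* (x !) (y !) {{x !≢0}} {{y !≢0}}))) ⟩
  ℕtoℚ p * ℕtoℚ q * (recip 2 * (invFact x * invFact y) * invFact (x + y))
    ≡⟨ solve 6 (λ p q h a b c → p :* q :* (h :* (a :* b) :* c) := (p :* a) :* (h :* (q :* b) :* c)) refl
         (ℕtoℚ p) (ℕtoℚ q) (recip 2) (invFact x) (invFact y) (invFact (x + y)) ⟩
  rowWeight x * (columnWeight y * invFact (x + y))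
    ∎
  where
  open ≡-Reasoning
  p = (2 ℕ.* x) !
  q = (2 ℕ.* y) !
  2x!y!≢0 : ℕ.NonZero (2 ℕ.* (x ! ℕ.* y !))
  2x!y!≢0 = m*n≢0 2 (x ! ℕ.* y !) {{_}} {{x !* y !≢0}}

RHS-factor : ℕ → ℕ → ℕ → ℕ → ℚ
RHS-factor a b n i = ℕtoℚ ((2 ℕ.* a + 2 ℕ.* i) ! ℕ.* (2 ℕ.* b + 2 ℕ.* i) ! ℕ.* i !)
  * invFact (a + i) * invFact (b + i) * invFact (a + b + n + i)

RHS-factor-split : ∀ a b n i → recip 2 * RHS-factor a b n i
  ≡ rowWeight (i + a) * columnWeight (i + b) * ℕtoℚ (i !) * invFact (a + b + n + i)
RHS-factor-split a b n i = begin
  recip 2 * (ℕtoℚ (X ℕ.* Y ℕ.* i !) * u * v * w)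
    ≡⟨ cong (λ z → recip 2 * (z * u * v * w)) (trans (ℕtoℚ-homo-* (X ℕ.* Y) (i !)) (cong (_* ℕtoℚ (i !)) (ℕtoℚ-homo-* X Y))) ⟩
  recip 2 * (ℕtoℚ X * ℕtoℚ Y * ℕtoℚ (i !) * u * v * w)
    ≡⟨ solve 7 (λ h x y f u v w → h :* (x :* y :* f :* u :* v :* w) := x :* u :* (h :* (y :* v)) :* f :* w) refl
         (recip 2) (ℕtoℚ X) (ℕtoℚ Y) (ℕtoℚ (i !)) u v w ⟩
  ℕtoℚ X * u * (recip 2 * (ℕtoℚ Y * v)) * ℕtoℚ (i !) * w
    ≡⟨ cong₂ (λ r c → r * c * ℕtoℚ (i !) * w)
         (cong₂ (λ k l → ℕtoℚ (k !) * invFact l) (double i a) (ℕP.+-comm a i))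
         (cong₂ (λ k l → recip 2 * (ℕtoℚ (k !) * invFact l)) (double i b) (ℕP.+-comm b i)) ⟩
  rowWeight (i + a) * columnWeight (i + b) * ℕtoℚ (i !) * w
    ∎
  where
  open ≡-Reasoning
  X = (2 ℕ.* a + 2 ℕ.* i) !
  Y = (2 ℕ.* b + 2 ℕ.* i) !
  u = invFact (a + i)
  v = invFact (b + i)
  w = invFact (a + b + n + i)
  double : ∀ i a → 2 ℕ.* a + 2 ℕ.* i ≡ 2 ℕ.* (i + a)
  double = solve-∀

RHS-factorisation : ∀ a b n → RHS a b n ≡ sgn (n C 2) *
  (∏< n (λ i → rowWeight (suc i + a)) * ∏< n (λ j → columnWeight (suc j + b)) *
   (∏< n (λ i → ℕtoℚ (i !)) * ∏< n (λ i → invFact (a + b + n + suc i))))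
RHS-factorisation a b n = begin
  RHS a b n
    ≡⟨ cong₂ _*_ coefficient (prod1to≡∏< n (RHS-factor a b n)) ⟩
  sgn (n C 2) * (recip (2 ℕ.^ n) {{m^n≢0 2 n}} * invFact n) * ∏< n T
    ≡⟨ solve 4 (λ s h g t → s :* (h :* g) :* t := s :* (g :* (h :* t))) refl
         (sgn (n C 2)) (recip (2 ℕ.^ n) {{m^n≢0 2 n}}) (invFact n) (∏< n T) ⟩
  sgn (n C 2) * (invFact n * (recip (2 ℕ.^ n) {{m^n≢0 2 n}} * ∏< n T))
    ≡⟨ cong (λ z → sgn (n C 2) * (invFact n * z)) halves ⟩
  sgn (n C 2) * (invFact n * (Rw * Cw * Fₛ * I))
    ≡⟨ cong (λ z → sgn (n C 2) * (invFact n * (Rw * Cw * z * I))) (∏<-fact-suc n) ⟩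
  sgn (n C 2) * (invFact n * (Rw * Cw * (F * ℕtoℚ (n !)) * I))
    ≡⟨ solve 7 (λ s g r c f k i → s :* (g :* (r :* c :* (f :* k) :* i)) := s :* (r :* c :* (f :* i)) :* (g :* k)) refl
         (sgn (n C 2)) (invFact n) Rw Cw F (ℕtoℚ (n !)) I ⟩
  sgn (n C 2) * (Rw * Cw * (F * I)) * (invFact n * ℕtoℚ (n !))
    ≡⟨ cong (sgn (n C 2) * (Rw * Cw * (F * I)) *_) (recip-inverseˡ (n !) {{n !≢0}}) ⟩
  sgn (n C 2) * (Rw * Cw * (F * I)) * 1ℚ
    ≡⟨ ℚP.*-identityʳ _ ⟩
  sgn (n C 2) * (Rw * Cw * (F * I))
    ∎
  where
  open ≡-Reasoning
  T : ℕ → ℚ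
  T i = RHS-factor a b n (suc i)
  Rw = ∏< n (λ i → rowWeight (suc i + a))
  Cw = ∏< n (λ j → columnWeight (suc j + b))
  F  = ∏< n (λ i → ℕtoℚ (i !))
  Fₛ = ∏< n (λ i → ℕtoℚ (suc i !))
  I  = ∏< n (λ i → invFact (a + b + n + suc i))
  coefficient : _/_ (negOnePow (n C 2)) (2 ℕ.^ n ℕ.* n !) {{m*n≢0 (2 ℕ.^ n) (n !) {{m^n≢0 2 n}} {{n !≢0}}}}
              ≡ sgn (n C 2) * (recip (2 ℕ.^ n) {{m^n≢0 2 n}} * invFact n)
  coefficient = trans (/≡*recip (negOnePow (n C 2)) (2 ℕ.^ n ℕ.* n !) {{m*n≢0 (2 ℕ.^ n) (n !) {{m^n≢0 2 n}} {{n !≢0}}}})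
    (cong₂ _*_ (ℤtoℚ-negOnePow (n C 2)) (recip-* (2 ℕ.^ n) (n !) {{m^n≢0 2 n}} {{n !≢0}}))
  halves : recip (2 ℕ.^ n) {{m^n≢0 2 n}} * ∏< n T ≡ Rw * Cw * Fₛ * I
  halves = begin
    recip (2 ℕ.^ n) {{m^n≢0 2 n}} * ∏< n T        ≡⟨ cong (_* ∏< n T) (∏<-const-recip 2 n) ⟩
    ∏< n (λ _ → recip 2) * ∏< n T                 ≡⟨ sym (∏<-distrib-* n _ T) ⟩
    ∏< n (λ i → recip 2 * T i)                    ≡⟨ ∏<-cong n (λ i → RHS-factor-split a b n (suc i)) ⟩
    ∏< n (λ i → rowWeight (suc i + a) * columnWeight (suc i + b) * ℕtoℚ (suc i !) * invFact (a + b + n + suc i))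
                                                  ≡⟨ ∏<-distrib-* n _ _ ⟩
    ∏< n (λ i → rowWeight (suc i + a) * columnWeight (suc i + b) * ℕtoℚ (suc i !)) * I
                                                  ≡⟨ cong (_* I) (∏<-distrib-* n _ _) ⟩
    ∏< n (λ i → rowWeight (suc i + a) * columnWeight (suc i + b)) * Fₛ * I
                                                  ≡⟨ cong (λ z → z * Fₛ * I) (∏<-distrib-* n _ _) ⟩
    Rw * Cw * Fₛ * I                              ∎

lemma2 : (a b n : ℕ) → 1 ≤ n →
    det n (λ (i j : Fin n) → S (suc (toℕ i) + a) (suc (toℕ j) + b)) ≡ RHS a b n
lemma2 a b n _ = begin
  det n (λ i j → S (suc (toℕ i) + a) (suc (toℕ j) + b))
    ≡⟨ det≡det′ n _ (λ i j → r i * (c j * invFactHankel (2 + (a + b)) i j)) (λ i j → S-as-Hankel (toℕ i) (toℕ j)) ⟩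
  det′ n (λ i j → r i * (c j * invFactHankel (2 + (a + b)) i j))
    ≡⟨ det′-scaleRows n r _ ⟩
  ∏< n r * det′ n (λ i j → c j * invFactHankel (2 + (a + b)) i j)
    ≡⟨ cong (∏< n r *_) (det′-scaleCols n c _) ⟩
  ∏< n r * (∏< n c * det′ n (invFactHankel (2 + (a + b))))
    ≡⟨ cong (λ d → ∏< n r * (∏< n c * d)) (det′-invFactHankel (a + b) n) ⟩
  ∏< n r * (∏< n c * (sgn (n C 2) * Π))
    ≡⟨ solve 4 (λ r c s p → r :* (c :* (s :* p)) := s :* (r :* c :* p)) refl (∏< n r) (∏< n c) (sgn (n C 2)) Π ⟩
  sgn (n C 2) * (∏< n r * ∏< n c * Π)
    ≡⟨ sym (RHS-factorisation a b n) ⟩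
  RHS a b n
    ∎
  where
  open ≡-Reasoning
  r c : ℕ → ℚ
  r i = rowWeight (suc i + a)
  c j = columnWeight (suc j + b)
  Π = ∏< n (λ i → ℕtoℚ (i !)) * ∏< n (λ i → invFact (a + b + n + suc i))
  index : ∀ a b i j → suc i + a + (suc j + b) ≡ 2 + (a + b) + i + j
  index = solve-∀
  S-as-Hankel : ∀ i j → S (suc i + a) (suc j + b) ≡ r i * (c j * invFactHankel (2 + (a + b)) i j)
  S-as-Hankel i j = trans (S-factorisation (suc i + a) (suc j + b)) (cong (λ k → r i * (c j * invFact k)) (index a b i j))
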